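{- Let $\mathcal{C}\subseteq\mathbb{R}^n$ be a full-dimensional pointed polyhedral cone with extreme rays $R_1,\dots,R_p$, and let $v=\{v_1,\dots,v_p\}$ be generators with $R_i=\mathbb{R}_{\geq 0}v_i$. Let $\mathcal{B}=\{B_1,\dots,B_r\}$ be a set of real $n\times n$ matrices with $B_1=I_n$. Put $Q=\sum_{i=1}^p v_i v_i^T$ and, for $1\le i,j\le p$, $$w_{ij}=\left(v_i^TQ^{ -1}B_1v_j,\ \dots,\ v_i^TQ^{ -1}B_rv_j\right).$$ Then $\mathrm{Lin}_v(\mathcal{C},\mathcal{B})$ is exactly the group of permutations $\sigma\in\mathrm{Sym}(p)$ preserving the directed colored graph on vertex set $\{1,\dots,p\}$ in which the (directed) edge $(i,j)$, $i\neq j$, has color $w_{ij}$ and the vertex $i$ has color $w_{ii}$; i.e. the group of all $\sigma\in\mathrm{Sym}(p)$ with $w_{\sigma(i)\sigma(j)}=w_{ij}$ for all $1\le i,j\le p$.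
   Context: A polyhedral cone in $\mathbb{R}^n$ is the set of vectors satisfying finitely many homogeneous linear inequalities; it is assumed full-dimensional and containing no nontrivial linear subspace, so it is generated by its finitely many extreme rays. ($Q$ is then positive definite, hence invertible.) $\mathrm{GL}_v(\mathcal{C})$ denotes the group of matrices $A\in\mathrm{GL}_n(\mathbb{R})$ for which there is $\sigma\in\mathrm{Sym}(p)$ with $Av_i=v_{\sigma(i)}$ for all $i$. $\mathrm{GL}_v(\mathcal{C},\mathcal{B})=\{A\in\mathrm{GL}_v(\mathcal{C}) : AB=BA \text{ for all } B\in\mathcal{B}\}$, and $\mathrm{Lin}_v(\mathcal{C},\mathcal{B})$ is the group of permutations $\sigma\in\mathrm{Sym}(p)$ for which there exists $A\in\mathrm{GL}_v(\mathcal{C},\mathcal{B})$ with $Av_i=v_{\sigma(i)}$ for $1\le i\le p$. -}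

module Defs where

open import Level using (0ℓ)
open import Data.Nat using (ℕ; zero; suc)
open import Data.Fin using (Fin; zero; suc)
open import Data.Fin.Permutation using (Permutation′; _⟨$⟩ʳ_)
open import Data.Product using (Σ; ∃; _×_; _,_)
open import Relation.Binary.PropositionalEquality using (_≡_)
open import Relation.Binary.Core using (Rel)
open import Relation.Binary.Structures using (IsTotalOrder)
open import Relation.Nullary using (¬_)
open import Algebra.Core using (Op₁; Op₂)
open import Algebra.Structures using (IsCommutativeRing)

-- The real numbers, axiomatised as a Dedekind-complete ordered field
-- (unique up to isomorphism), with propositional equality on the carrier.
record RealField : Set₁ where
  infixl 7 _*_
  infixl 6 _+_
  infix 4 _≤_
  field
    Carrier : Set
    _+_ _*_ : Op₂ Carrier
    -_ : Op₁ Carrier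
    0# 1# : Carrier
    _≤_ : Rel Carrier 0ℓ
    isCommutativeRing : IsCommutativeRing _≡_ _+_ _*_ -_ 0# 1#
    0≢1 : ¬ (0# ≡ 1#)
    inverse : ∀ x → ¬ (x ≡ 0#) → ∃ λ y → x * y ≡ 1#
    isTotalOrder : IsTotalOrder _≡_ _≤_
    +-monoˡ-≤ : ∀ {x y} z → x ≤ y → x + z ≤ y + z
    *-nonneg : ∀ {x y} → 0# ≤ x → 0# ≤ y → 0# ≤ x * y
    complete : (S : Carrier → Set) → ∃ S → (∃ λ b → ∀ x → S x → x ≤ b) →
               ∃ λ s → (∀ x → S x → x ≤ s) × (∀ b → (∀ x → S x → x ≤ b) → s ≤ b)

module Linear (R : RealField) where
  open RealField R public

  Vect : ℕ → Set
  Vect n = Fin n → Carrier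

  Mat : ℕ → Set
  Mat n = Fin n → Fin n → Carrier

  sumF : (n : ℕ) → (Fin n → Carrier) → Carrier
  sumF zero f = 0#
  sumF (suc n) f = f zero + sumF n (λ i → f (suc i))

  _·_ : {n : ℕ} → Vect n → Vect n → Carrier
  _·_ {n} x y = sumF n (λ a → x a * y a)

  _⊛_ : {n : ℕ} → Mat n → Vect n → Vect n
  _⊛_ {n} A x a = sumF n (λ b → A a b * x b)

  _⊗_ : {n : ℕ} → Mat n → Mat n → Mat n
  _⊗_ {n} A B a c = sumF n (λ b → A a b * B b c)

  Id : {n : ℕ} → Mat n
  Id {n} a b with Data.Fin._≟_ a b
  ... | Relation.Nullary.yes _ = 1#
  ... | Relation.Nullary.no _ = 0#

  _-ᵥ_ : {n : ℕ} → Vect n → Vect n → Vect n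
  (x -ᵥ y) a = x a + (- (y a))

  _*ᵥ_ : {n : ℕ} → Carrier → Vect n → Vect n
  (c *ᵥ x) a = c * x a

  _≐_ : {n : ℕ} → Vect n → Vect n → Set
  x ≐ y = ∀ a → x a ≡ y a

  _≐ₘ_ : {n : ℕ} → Mat n → Mat n → Set
  A ≐ₘ B = ∀ a b → A a b ≡ B a b

  zeroV : {n : ℕ} → Vect n
  zeroV a = 0#

  PolyCone : {n m : ℕ} → (Fin m → Vect n) → Vect n → Set
  PolyCone H x = ∀ k → 0# ≤ (H k · x)

  -- full-dimensional: the linear span of C (= C - C for a convex cone) is R^n
  FullDim : {n : ℕ} → (Vect n → Set) → Set
  FullDim {n} C = (x : Vect n) → ∃ λ y → ∃ λ z → C y × C z × (x ≐ (y -ᵥ z))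

  Pointed : {n : ℕ} → (Vect n → Set) → Set
  Pointed {n} C = (x : Vect n) → C x → C (zeroV -ᵥ x) → x ≐ zeroV

  InRay : {n : ℕ} → Vect n → Vect n → Set
  InRay x y = ∃ λ c → 0# ≤ c × (y ≐ (c *ᵥ x))

  IsExtremeRay : {n : ℕ} → (Vect n → Set) → Vect n → Set
  IsExtremeRay {n} C x =
    ¬ (x ≐ zeroV) × C x ×
    ((y z : Vect n) → C y → C z → InRay x (λ a → y a + z a) → InRay x y × InRay x z)

  Invertible : {n : ℕ} → Mat n → Set
  Invertible {n} A = ∃ λ (A' : Mat n) → ((A ⊗ A') ≐ₘ Id) × ((A' ⊗ A) ≐ₘ Id)

  InLin : {n p r : ℕ} → (Fin p → Vect n) → (Fin r → Mat n) → Permutation′ p → Set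
  InLin {n} {p} {r} v B σ =
    ∃ λ (A : Mat n) → Invertible A ×
      (∀ i → (A ⊛ v i) ≐ v (σ ⟨$⟩ʳ i)) ×
      (∀ k → (A ⊗ B k) ≐ₘ (B k ⊗ A))

  Qmat : {n p : ℕ} → (Fin p → Vect n) → Mat n
  Qmat {n} {p} v a b = sumF p (λ i → v i a * v i b)

  wcol : {n p r : ℕ} → (Fin p → Vect n) → (Fin r → Mat n) → Mat n →
         Fin p → Fin p → Fin r → Carrier
  wcol v B Qinv i j k = v i · (Qinv ⊛ (B k ⊛ v j))

-- Let V be the n×p matrix with columns v_i, so Q = V Vᵀ and w_ijk = (Vᵀ Q⁻¹ B_k V)_ij.
-- Since V (Vᵀ Q⁻¹) = I, a matrix is determined by its action on the v_i.
-- If σ preserves all colours, A_σ = V_σ Vᵀ Q⁻¹ (V_σ having columns v_σ(i)) sends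
-- B_k v_j to B_k v_σ(j); with B_0 = I it sends v_j to v_σ(j), so comparing on the
-- generators it commutes with every B_k and is inverted by A_σ⁻¹.
-- Conversely, if A v_i = v_σ(i) then A Q Aᵀ = Q, hence Aᵀ Q⁻¹ A = Q⁻¹, and
-- w_σ(i)σ(j)k = v_iᵀ Aᵀ Q⁻¹ B_k A v_j = v_iᵀ Aᵀ Q⁻¹ A B_k v_j = w_ijk.
module Submission where

open import Defs
open import Level using (0ℓ)
open import Data.Nat using (ℕ; zero; suc)
open import Data.Fin using (Fin; zero; suc; punchIn; _≟_)
open import Data.Fin.Properties using (punchInᵢ≢i)
open import Data.Fin.Permutation using (Permutation′; _⟨$⟩ʳ_; _⟨$⟩ˡ_; inverseʳ; flip)
open import Data.Empty using (⊥-elim)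
open import Data.Product using (∃; _×_; _,_)
open import Function.Base using (_∘_)
open import Function.Bundles using (_⇔_; mk⇔)
open import Relation.Nullary using (yes; no)
open import Relation.Binary.Bundles using (Setoid)
open import Relation.Binary.PropositionalEquality
  using (_≡_; _≢_; refl; sym; trans; cong; cong₂; setoid; module ≡-Reasoning)
open import Algebra.Bundles using (CommutativeRing)
import Algebra.Properties.Semiring.Sum as SemiringSum
import Data.Vec.Functional.Relation.Binary.Pointwise.Properties as Pointwise
import Relation.Binary.Reasoning.Setoid as SetoidReasoning

module Matrices (ℝ : RealField) where
  open Linear ℝ

  ring : CommutativeRing 0ℓ 0ℓ
  ring = record { isCommutativeRing = isCommutativeRing }

  open CommutativeRing ring
    using (+-identityʳ; *-comm; *-assoc; zeroˡ; zeroʳ; *-identityˡ; *-identityʳ; semiring)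
  open SemiringSum semiring
    using (sum; sum-cong-≗; ∑-comm; ∑-permute; *-distribˡ-sum; *-distribʳ-sum;
           sum-remove; sum-replicate-zero)

  private
    variable
      l m p q : ℕ

  sumF≡sum : ∀ n (f : Fin n → Carrier) → sumF n f ≡ sum f
  sumF≡sum zero    f = refl
  sumF≡sum (suc n) f = cong (f zero +_) (sumF≡sum n (f ∘ suc))

  sumF-via-sum : ∀ n {f g : Fin n → Carrier} → sum f ≡ sum g → sumF n f ≡ sumF n g
  sumF-via-sum n {f} {g} eq = trans (sumF≡sum n f) (trans eq (sym (sumF≡sum n g)))

  sumF-cong : ∀ n {f g : Fin n → Carrier} → (∀ i → f i ≡ g i) → sumF n f ≡ sumF n g
  sumF-cong n eq = sumF-via-sum n (sum-cong-≗ eq)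

  *-distribˡ-sumF : ∀ n x (f : Fin n → Carrier) → x * sumF n f ≡ sumF n (λ i → x * f i)
  *-distribˡ-sumF n x f = begin
    x * sumF n f             ≡⟨ cong (x *_) (sumF≡sum n f) ⟩
    x * sum f                ≡⟨ *-distribˡ-sum x f ⟩
    sum (λ i → x * f i)      ≡⟨ sym (sumF≡sum n _) ⟩
    sumF n (λ i → x * f i)   ∎
    where open ≡-Reasoning

  *-distribʳ-sumF : ∀ n x (f : Fin n → Carrier) → sumF n f * x ≡ sumF n (λ i → f i * x)
  *-distribʳ-sumF n x f = begin
    sumF n f * x             ≡⟨ cong (_* x) (sumF≡sum n f) ⟩
    sum f * x                ≡⟨ *-distribʳ-sum x f ⟩
    sum (λ i → f i * x)      ≡⟨ sym (sumF≡sum n _) ⟩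
    sumF n (λ i → f i * x)   ∎
    where open ≡-Reasoning

  sumF-comm : ∀ m n (f : Fin m → Fin n → Carrier) →
              sumF m (λ i → sumF n (f i)) ≡ sumF n (λ j → sumF m (λ i → f i j))
  sumF-comm m n f = begin
    sumF m (λ i → sumF n (f i))          ≡⟨ sumF≡sum m _ ⟩
    sum (λ i → sumF n (f i))             ≡⟨ sum-cong-≗ {m} (λ i → sumF≡sum n (f i)) ⟩
    sum (λ i → sum (f i))                ≡⟨ ∑-comm f ⟩
    sum (λ j → sum (λ i → f i j))        ≡⟨ sum-cong-≗ {n} (λ j → sym (sumF≡sum m _)) ⟩
    sum (λ j → sumF m (λ i → f i j))     ≡⟨ sym (sumF≡sum n _) ⟩
    sumF n (λ j → sumF m (λ i → f i j))  ∎
    where open ≡-Reasoning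

  sumF-permute : ∀ n (σ : Permutation′ n) (f : Fin n → Carrier) →
                 sumF n (f ∘ (σ ⟨$⟩ʳ_)) ≡ sumF n f
  sumF-permute n σ f = sumF-via-sum n (sym (∑-permute f σ))

  sumF-single : ∀ n (f : Fin n → Carrier) i → (∀ j → j ≢ i → f j ≡ 0#) → sumF n f ≡ f i
  sumF-single (suc n) f i f≡0 = begin
    sumF (suc n) f                        ≡⟨ sumF≡sum (suc n) f ⟩
    sum f                                 ≡⟨ sum-remove {i = i} f ⟩
    f i + sum (f ∘ punchIn i)    ≡⟨ cong (f i +_) rest≡0 ⟩
    f i + 0#                              ≡⟨ +-identityʳ (f i) ⟩
    f i                                   ∎
    where
    open ≡-Reasoning
    rest≡0 : sum (f ∘ punchIn i) ≡ 0#
    rest≡0 = trans (sum-cong-≗ (λ j → f≡0 _ (punchInᵢ≢i i j))) (sum-replicate-zero n)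

  Id-diagonal : ∀ {n} (a : Fin n) → Id a a ≡ 1#
  Id-diagonal a with a ≟ a
  ... | yes _  = refl
  ... | no a≢a = ⊥-elim (a≢a refl)

  Id-offDiagonal : ∀ {n} {a b : Fin n} → a ≢ b → Id a b ≡ 0#
  Id-offDiagonal {a = a} {b} a≢b with a ≟ b
  ... | yes a≡b = ⊥-elim (a≢b a≡b)
  ... | no _    = refl

  Id-symmetric : ∀ {n} (a b : Fin n) → Id a b ≡ Id b a
  Id-symmetric a b with a ≟ b
  ... | yes refl = sym (Id-diagonal a)
  ... | no a≢b   = sym (Id-offDiagonal (a≢b ∘ sym))

  Matrix : ℕ → ℕ → Set
  Matrix l m = Fin l → Fin m → Carrier

  infixl 7 _∙_
  _∙_ : Matrix l m → Matrix m q → Matrix l q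
  _∙_ {m = m} A B a c = sumF m (λ b → A a b * B b c)

  infix 8 _ᵀ
  _ᵀ : Matrix l m → Matrix m l
  (A ᵀ) a b = A b a

  -- Permutes columns; (M ∙ N) ⟪ σ ⟫ and M ∙ N ⟪ σ ⟫ are definitionally equal,
  -- which the reasoning chains below use silently.
  infix 8 _⟪_⟫
  _⟪_⟫ : Matrix l p → Permutation′ p → Matrix l p
  (M ⟪ σ ⟫) a j = M a (σ ⟨$⟩ʳ j)

  Matrix-setoid : ℕ → ℕ → Setoid 0ℓ 0ℓ
  Matrix-setoid l m = Pointwise.setoid (Pointwise.setoid (setoid Carrier) m) l

  infix 4 _≈_
  _≈_ : Matrix l m → Matrix l m → Set
  _≈_ {l} {m} = Setoid._≈_ (Matrix-setoid l m)

  module ≈-Reasoning {l m : ℕ} = SetoidReasoning (Matrix-setoid l m)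

  ≈-sym : {A B : Matrix l m} → A ≈ B → B ≈ A
  ≈-sym = Setoid.sym (Matrix-setoid _ _)

  ≈-trans : {A B C : Matrix l m} → A ≈ B → B ≈ C → A ≈ C
  ≈-trans = Setoid.trans (Matrix-setoid _ _)

  ∙-cong : {A A′ : Matrix l m} {B B′ : Matrix m q} → A ≈ A′ → B ≈ B′ → A ∙ B ≈ A′ ∙ B′
  ∙-cong {m = m} A≈A′ B≈B′ a c = sumF-cong m (λ b → cong₂ _*_ (A≈A′ a b) (B≈B′ b c))

  ∙-congˡ : (A : Matrix l m) {B B′ : Matrix m q} → B ≈ B′ → A ∙ B ≈ A ∙ B′
  ∙-congˡ A = ∙-cong (λ _ _ → refl)

  ∙-congʳ : {A A′ : Matrix l m} (B : Matrix m q) → A ≈ A′ → A ∙ B ≈ A′ ∙ B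
  ∙-congʳ B A≈A′ = ∙-cong A≈A′ (λ _ _ → refl)

  ∙-assoc : ∀ {k} (A : Matrix l m) (B : Matrix m k) (C : Matrix k q) → A ∙ B ∙ C ≈ A ∙ (B ∙ C)
  ∙-assoc {m = m} {k = k} A B C a c = begin
    sumF k (λ b → sumF m (λ d → A a d * B d b) * C b c)
      ≡⟨ sumF-cong k (λ b → *-distribʳ-sumF m (C b c) _) ⟩
    sumF k (λ b → sumF m (λ d → A a d * B d b * C b c))
      ≡⟨ sumF-comm k m _ ⟩
    sumF m (λ d → sumF k (λ b → A a d * B d b * C b c))
      ≡⟨ sumF-cong m (λ d → sumF-cong k (λ b → *-assoc (A a d) (B d b) (C b c))) ⟩
    sumF m (λ d → sumF k (λ b → A a d * (B d b * C b c)))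
      ≡⟨ sumF-cong m (λ d → sym (*-distribˡ-sumF k (A a d) _)) ⟩
    sumF m (λ d → A a d * sumF k (λ b → B d b * C b c))
      ∎
    where open ≡-Reasoning

  ∙-identityʳ : (A : Matrix l m) → A ∙ Id ≈ A
  ∙-identityʳ {m = m} A a c = begin
    sumF m (λ b → A a b * Id b c) ≡⟨ sumF-single m _ c off-diagonal ⟩
    A a c * Id c c                ≡⟨ cong (A a c *_) (Id-diagonal c) ⟩
    A a c * 1#                    ≡⟨ *-identityʳ (A a c) ⟩
    A a c                         ∎
    where
    open ≡-Reasoning
    off-diagonal : ∀ b → b ≢ c → A a b * Id b c ≡ 0#
    off-diagonal b b≢c = trans (cong (A a b *_) (Id-offDiagonal b≢c)) (zeroʳ (A a b))

  ∙-identityˡ : (A : Matrix l m) → Id ∙ A ≈ A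
  ∙-identityˡ {l = l} A a c = begin
    sumF l (λ b → Id a b * A b c) ≡⟨ sumF-single l _ a off-diagonal ⟩
    Id a a * A a c                ≡⟨ cong (_* A a c) (Id-diagonal a) ⟩
    1# * A a c                    ≡⟨ *-identityˡ (A a c) ⟩
    A a c                         ∎
    where
    open ≡-Reasoning
    off-diagonal : ∀ b → b ≢ a → Id a b * A b c ≡ 0#
    off-diagonal b b≢a = trans (cong (_* A b c) (Id-offDiagonal (b≢a ∘ sym))) (zeroˡ (A b c))

  ᵀ-∙ : (A : Matrix l m) (B : Matrix m q) → (A ∙ B) ᵀ ≈ B ᵀ ∙ A ᵀ
  ᵀ-∙ {m = m} A B a c = sumF-cong m (λ b → *-comm (A c b) (B b a))

  ᵀ-cong : {A B : Matrix l m} → A ≈ B → A ᵀ ≈ B ᵀ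
  ᵀ-cong A≈B a b = A≈B b a

  Idᵀ : Id ᵀ ≈ Id {l}
  Idᵀ a b = Id-symmetric b a

  ⟪⟫-cong : {M N : Matrix l p} (σ : Permutation′ p) → M ≈ N → M ⟪ σ ⟫ ≈ N ⟪ σ ⟫
  ⟪⟫-cong σ M≈N a j = M≈N a (σ ⟨$⟩ʳ j)

  ⟪⟫-inverse : (M : Matrix l p) (σ : Permutation′ p) → M ⟪ σ ⟫ ⟪ flip σ ⟫ ≈ M
  ⟪⟫-inverse M σ a j = cong (M a) (inverseʳ σ)

  ⟪⟫-∙-invariant : (M : Matrix l p) {N : Matrix p p} (σ : Permutation′ p) →
                   (∀ i j → N (σ ⟨$⟩ʳ i) (σ ⟨$⟩ʳ j) ≡ N i j) → M ⟪ σ ⟫ ∙ N ≈ (M ∙ N) ⟪ σ ⟫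
  ⟪⟫-∙-invariant {p = p} M {N} σ N-invariant a j = begin
    sumF p (λ i → M a (σ ⟨$⟩ʳ i) * N i j)
      ≡⟨ sumF-cong p (λ i → cong (M a (σ ⟨$⟩ʳ i) *_) (sym (N-invariant i j))) ⟩
    sumF p (λ i → M a (σ ⟨$⟩ʳ i) * N (σ ⟨$⟩ʳ i) (σ ⟨$⟩ʳ j))
      ≡⟨ sumF-permute p σ (λ i → M a i * N i (σ ⟨$⟩ʳ j)) ⟩
    sumF p (λ i → M a i * N i (σ ⟨$⟩ʳ j))
      ∎
    where open ≡-Reasoning

  ⟪⟫-∙-ᵀ : (M : Matrix l p) (N : Matrix m p) (σ : Permutation′ p) →
           M ⟪ σ ⟫ ∙ N ⟪ σ ⟫ ᵀ ≈ M ∙ N ᵀ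
  ⟪⟫-∙-ᵀ {p = p} M N σ a c = sumF-permute p σ (λ i → M a i * N c i)

  leftInverse≈rightInverse : {X Y Z : Matrix l l} → Y ∙ X ≈ Id → X ∙ Z ≈ Id → Y ≈ Z
  leftInverse≈rightInverse {X = X} {Y} {Z} Y∙X≈Id X∙Z≈Id = begin
    Y            ≈⟨ ∙-identityʳ Y ⟨
    Y ∙ Id       ≈⟨ ∙-congˡ Y X∙Z≈Id ⟨
    Y ∙ (X ∙ Z)  ≈⟨ ∙-assoc Y X Z ⟨
    Y ∙ X ∙ Z    ≈⟨ ∙-congʳ Z Y∙X≈Id ⟩
    Id ∙ Z       ≈⟨ ∙-identityˡ Z ⟩
    Z            ∎
    where open ≈-Reasoning

  symmetric-rightInverse⇒leftInverse : {A X : Matrix l l} →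
                                       A ᵀ ≈ A → A ∙ X ≈ Id → X ∙ A ≈ Id
  symmetric-rightInverse⇒leftInverse {A = A} {X} Aᵀ≈A A∙X≈Id = begin
    X ∙ A      ≈⟨ ∙-congʳ A (leftInverse≈rightInverse Xᵀ∙A≈Id A∙X≈Id) ⟨
    X ᵀ ∙ A    ≈⟨ Xᵀ∙A≈Id ⟩
    Id         ∎
    where
    open ≈-Reasoning
    Xᵀ∙A≈Id : X ᵀ ∙ A ≈ Id
    Xᵀ∙A≈Id = begin
      X ᵀ ∙ A     ≈⟨ ∙-congˡ (X ᵀ) Aᵀ≈A ⟨
      X ᵀ ∙ A ᵀ   ≈⟨ ᵀ-∙ A X ⟨
      (A ∙ X) ᵀ   ≈⟨ ᵀ-cong A∙X≈Id ⟩
      Id ᵀ        ≈⟨ Idᵀ ⟩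
      Id          ∎

  ∙-cancelʳ : {X Y : Matrix l m} {V : Matrix m p} (R : Matrix p m) →
              V ∙ R ≈ Id → X ∙ V ≈ Y ∙ V → X ≈ Y
  ∙-cancelʳ {X = X} {Y} {V} R V∙R≈Id X∙V≈Y∙V = begin
    X            ≈⟨ ∙-identityʳ X ⟨
    X ∙ Id       ≈⟨ ∙-congˡ X V∙R≈Id ⟨
    X ∙ (V ∙ R)  ≈⟨ ∙-assoc X V R ⟨
    X ∙ V ∙ R    ≈⟨ ∙-congʳ R X∙V≈Y∙V ⟩
    Y ∙ V ∙ R    ≈⟨ ∙-assoc Y V R ⟩
    Y ∙ (V ∙ R)  ≈⟨ ∙-congˡ Y V∙R≈Id ⟩
    Y ∙ Id       ≈⟨ ∙-identityʳ Y ⟩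
    Y            ∎
    where open ≈-Reasoning

  gram-invariant : {A : Matrix l l} {V : Matrix l p} (σ : Permutation′ p) →
                   A ∙ V ≈ V ⟪ σ ⟫ → A ∙ (V ∙ V ᵀ) ∙ A ᵀ ≈ V ∙ V ᵀ
  gram-invariant {A = A} {V} σ A∙V≈V⟪σ⟫ = begin
    A ∙ (V ∙ V ᵀ) ∙ A ᵀ      ≈⟨ ∙-congʳ (A ᵀ) (∙-assoc A V (V ᵀ)) ⟨
    A ∙ V ∙ V ᵀ ∙ A ᵀ        ≈⟨ ∙-assoc (A ∙ V) (V ᵀ) (A ᵀ) ⟩
    A ∙ V ∙ (V ᵀ ∙ A ᵀ)      ≈⟨ ∙-congˡ (A ∙ V) (ᵀ-∙ A V) ⟨
    A ∙ V ∙ (A ∙ V) ᵀ        ≈⟨ ∙-cong A∙V≈V⟪σ⟫ (ᵀ-cong A∙V≈V⟪σ⟫) ⟩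
    V ⟪ σ ⟫ ∙ V ⟪ σ ⟫ ᵀ      ≈⟨ ⟪⟫-∙-ᵀ V V σ ⟩
    V ∙ V ᵀ                  ∎
    where open ≈-Reasoning

  congruence-invariant-inverse : {A A′ X Y : Matrix l l} →
                                 A′ ∙ A ≈ Id → X ∙ Y ≈ Id → Y ∙ X ≈ Id →
                                 A ∙ X ∙ A ᵀ ≈ X → A ᵀ ∙ Y ∙ A ≈ Y
  congruence-invariant-inverse {A = A} {A′} {X} {Y} A′∙A≈Id X∙Y≈Id Y∙X≈Id A∙X∙Aᵀ≈X =
    ≈-sym (leftInverse≈rightInverse Y∙X≈Id X∙AᵀYA≈Id)
    where
    open ≈-Reasoning
    X∙Aᵀ≈A′∙X : X ∙ A ᵀ ≈ A′ ∙ X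
    X∙Aᵀ≈A′∙X = begin
      X ∙ A ᵀ              ≈⟨ ∙-identityˡ (X ∙ A ᵀ) ⟨
      Id ∙ (X ∙ A ᵀ)       ≈⟨ ∙-congʳ (X ∙ A ᵀ) A′∙A≈Id ⟨
      A′ ∙ A ∙ (X ∙ A ᵀ)   ≈⟨ ∙-assoc A′ A (X ∙ A ᵀ) ⟩
      A′ ∙ (A ∙ (X ∙ A ᵀ)) ≈⟨ ∙-congˡ A′ (∙-assoc A X (A ᵀ)) ⟨
      A′ ∙ (A ∙ X ∙ A ᵀ)   ≈⟨ ∙-congˡ A′ A∙X∙Aᵀ≈X ⟩
      A′ ∙ X               ∎
    X∙AᵀYA≈Id : X ∙ (A ᵀ ∙ Y ∙ A) ≈ Id
    X∙AᵀYA≈Id = begin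
      X ∙ (A ᵀ ∙ Y ∙ A)     ≈⟨ ∙-congˡ X (∙-assoc (A ᵀ) Y A) ⟩
      X ∙ (A ᵀ ∙ (Y ∙ A))   ≈⟨ ∙-assoc X (A ᵀ) (Y ∙ A) ⟨
      X ∙ A ᵀ ∙ (Y ∙ A)     ≈⟨ ∙-congʳ (Y ∙ A) X∙Aᵀ≈A′∙X ⟩
      A′ ∙ X ∙ (Y ∙ A)      ≈⟨ ∙-assoc A′ X (Y ∙ A) ⟩
      A′ ∙ (X ∙ (Y ∙ A))    ≈⟨ ∙-congˡ A′ (∙-assoc X Y A) ⟨
      A′ ∙ (X ∙ Y ∙ A)      ≈⟨ ∙-congˡ A′ (∙-congʳ A X∙Y≈Id) ⟩
      A′ ∙ (Id ∙ A)         ≈⟨ ∙-congˡ A′ (∙-identityˡ A) ⟩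
      A′ ∙ A                ≈⟨ A′∙A≈Id ⟩
      Id                    ∎

  module LinearSymmetries {n p r : ℕ} (v : Fin p → Vect n)
                          (B : Fin (suc r) → Mat n) (B₀≈Id : B zero ≈ Id) (Qinv : Mat n)
                          (Q∙Qinv≈Id : (Qmat v ⊗ Qinv) ≐ₘ Id) where

    -- Qmat v is V ∙ V ᵀ, and wcol v B Qinv i j k is W k i j, definitionally.
    V : Matrix n p
    V a i = v i a

    W : Fin (suc r) → Matrix p p
    W k = V ᵀ ∙ (Qinv ∙ (B k ∙ V))

    IsColourAutomorphism : Permutation′ p → Set
    IsColourAutomorphism σ =
      ∀ i j k → wcol v B Qinv (σ ⟨$⟩ʳ i) (σ ⟨$⟩ʳ j) k ≡ wcol v B Qinv i j k

    IsColourAutomorphism-flip : ∀ σ → IsColourAutomorphism σ → IsColourAutomorphism (flip σ)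
    IsColourAutomorphism-flip σ aut i j k = trans (sym (aut (σ ⟨$⟩ˡ i) (σ ⟨$⟩ˡ j) k))
      (cong₂ (λ x y → wcol v B Qinv x y k) (inverseʳ σ) (inverseʳ σ))

    V-rightInverse : V ∙ (V ᵀ ∙ Qinv) ≈ Id
    V-rightInverse = ≈-trans (≈-sym (∙-assoc V (V ᵀ) Qinv)) Q∙Qinv≈Id

    V-reconstruct : (X : Matrix n q) → V ∙ (V ᵀ ∙ (Qinv ∙ X)) ≈ X
    V-reconstruct X = begin
      V ∙ (V ᵀ ∙ (Qinv ∙ X))   ≈⟨ ∙-congˡ V (∙-assoc (V ᵀ) Qinv X) ⟨
      V ∙ (V ᵀ ∙ Qinv ∙ X)     ≈⟨ ∙-assoc V (V ᵀ ∙ Qinv) X ⟨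
      V ∙ (V ᵀ ∙ Qinv) ∙ X     ≈⟨ ∙-congʳ X V-rightInverse ⟩
      Id ∙ X                   ≈⟨ ∙-identityˡ X ⟩
      X                        ∎
      where open ≈-Reasoning

    extension : Permutation′ p → Mat n
    extension σ = V ⟪ σ ⟫ ∙ (V ᵀ ∙ Qinv)

    module _ (σ : Permutation′ p) (aut : IsColourAutomorphism σ) where

      extension-∙-B∙V : ∀ k → extension σ ∙ (B k ∙ V) ≈ (B k ∙ V) ⟪ σ ⟫
      extension-∙-B∙V k = begin
        V ⟪ σ ⟫ ∙ (V ᵀ ∙ Qinv) ∙ (B k ∙ V)  ≈⟨ ∙-assoc _ (V ᵀ ∙ Qinv) (B k ∙ V) ⟩
        V ⟪ σ ⟫ ∙ (V ᵀ ∙ Qinv ∙ (B k ∙ V))  ≈⟨ ∙-congˡ _ (∙-assoc (V ᵀ) Qinv (B k ∙ V)) ⟩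
        V ⟪ σ ⟫ ∙ W k                      ≈⟨ ⟪⟫-∙-invariant V σ (λ i j → aut i j k) ⟩
        (V ∙ W k) ⟪ σ ⟫                    ≈⟨ ⟪⟫-cong σ (V-reconstruct (B k ∙ V)) ⟩
        (B k ∙ V) ⟪ σ ⟫                    ∎
        where open ≈-Reasoning

      extension-∙-V : extension σ ∙ V ≈ V ⟪ σ ⟫
      extension-∙-V = begin
        extension σ ∙ V            ≈⟨ ∙-congˡ (extension σ) B₀∙V≈V ⟨
        extension σ ∙ (B zero ∙ V) ≈⟨ extension-∙-B∙V zero ⟩
        (B zero ∙ V) ⟪ σ ⟫         ≈⟨ ⟪⟫-cong σ B₀∙V≈V ⟩
        V ⟪ σ ⟫                    ∎
        where
        open ≈-Reasoning
        B₀∙V≈V : B zero ∙ V ≈ V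
        B₀∙V≈V = ≈-trans (∙-congʳ V B₀≈Id) (∙-identityˡ V)

      extension-commutes : ∀ k → extension σ ∙ B k ≈ B k ∙ extension σ
      extension-commutes k = ∙-cancelʳ (V ᵀ ∙ Qinv) V-rightInverse (begin
        extension σ ∙ B k ∙ V       ≈⟨ ∙-assoc (extension σ) (B k) V ⟩
        extension σ ∙ (B k ∙ V)     ≈⟨ extension-∙-B∙V k ⟩
        B k ∙ V ⟪ σ ⟫               ≈⟨ ∙-congˡ (B k) extension-∙-V ⟨
        B k ∙ (extension σ ∙ V)     ≈⟨ ∙-assoc (B k) (extension σ) V ⟨
        B k ∙ extension σ ∙ V       ∎)
        where open ≈-Reasoning

    extension-inverse : ∀ σ → IsColourAutomorphism σ → extension σ ∙ extension (flip σ) ≈ Id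
    extension-inverse σ aut = ∙-cancelʳ (V ᵀ ∙ Qinv) V-rightInverse (begin
      extension σ ∙ extension σ⁻¹ ∙ V    ≈⟨ ∙-assoc (extension σ) (extension σ⁻¹) V ⟩
      extension σ ∙ (extension σ⁻¹ ∙ V)  ≈⟨ ∙-congˡ (extension σ) (extension-∙-V σ⁻¹ aut⁻¹) ⟩
      (extension σ ∙ V) ⟪ σ⁻¹ ⟫          ≈⟨ ⟪⟫-cong σ⁻¹ (extension-∙-V σ aut) ⟩
      V ⟪ σ ⟫ ⟪ σ⁻¹ ⟫                    ≈⟨ ⟪⟫-inverse V σ ⟩
      V                                 ≈⟨ ∙-identityˡ V ⟨
      Id ∙ V                            ∎)
      where
      open ≈-Reasoning
      σ⁻¹ = flip σ
      aut⁻¹ = IsColourAutomorphism-flip σ aut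

    automorphism⇒InLin : ∀ σ → IsColourAutomorphism σ → InLin v B σ
    automorphism⇒InLin σ aut =
      extension σ ,
      (extension (flip σ) , extension-inverse σ aut , extension-inverse (flip σ) aut⁻¹) ,
      (λ i a → extension-∙-V σ aut a i) ,
      extension-commutes σ aut
      where aut⁻¹ = IsColourAutomorphism-flip σ aut

    Qinv∙Q≈Id : Qinv ∙ (V ∙ V ᵀ) ≈ Id
    Qinv∙Q≈Id = symmetric-rightInverse⇒leftInverse (ᵀ-∙ V (V ᵀ)) Q∙Qinv≈Id

    InLin⇒automorphism : ∀ σ → InLin v B σ → IsColourAutomorphism σ
    InLin⇒automorphism σ (A , (A′ , _ , A′∙A≈Id) , maps , commutes) i j k = W-invariant i j
      where
      open ≈-Reasoning
      A∙V≈V⟪σ⟫ : A ∙ V ≈ V ⟪ σ ⟫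
      A∙V≈V⟪σ⟫ a l = maps l a

      Aᵀ∙Qinv∙A≈Qinv : A ᵀ ∙ Qinv ∙ A ≈ Qinv
      Aᵀ∙Qinv∙A≈Qinv =
        congruence-invariant-inverse A′∙A≈Id Q∙Qinv≈Id Qinv∙Q≈Id (gram-invariant σ A∙V≈V⟪σ⟫)

      B∙A∙V≈A∙B∙V : B k ∙ (A ∙ V) ≈ A ∙ (B k ∙ V)
      B∙A∙V≈A∙B∙V = begin
        B k ∙ (A ∙ V)   ≈⟨ ∙-assoc (B k) A V ⟨
        B k ∙ A ∙ V     ≈⟨ ∙-congʳ V (commutes k) ⟨
        A ∙ B k ∙ V     ≈⟨ ∙-assoc A (B k) V ⟩
        A ∙ (B k ∙ V)   ∎

      Aᵀ∙Qinv∙A-cancel : A ᵀ ∙ (Qinv ∙ (A ∙ (B k ∙ V))) ≈ Qinv ∙ (B k ∙ V)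
      Aᵀ∙Qinv∙A-cancel = begin
        A ᵀ ∙ (Qinv ∙ (A ∙ (B k ∙ V)))   ≈⟨ ∙-congˡ (A ᵀ) (∙-assoc Qinv A (B k ∙ V)) ⟨
        A ᵀ ∙ (Qinv ∙ A ∙ (B k ∙ V))     ≈⟨ ∙-assoc (A ᵀ) (Qinv ∙ A) (B k ∙ V) ⟨
        A ᵀ ∙ (Qinv ∙ A) ∙ (B k ∙ V)     ≈⟨ ∙-congʳ (B k ∙ V) (∙-assoc (A ᵀ) Qinv A) ⟨
        A ᵀ ∙ Qinv ∙ A ∙ (B k ∙ V)       ≈⟨ ∙-congʳ (B k ∙ V) Aᵀ∙Qinv∙A≈Qinv ⟩
        Qinv ∙ (B k ∙ V)                 ∎

      W-invariant : V ⟪ σ ⟫ ᵀ ∙ (Qinv ∙ (B k ∙ V ⟪ σ ⟫)) ≈ W k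
      W-invariant = begin
        V ⟪ σ ⟫ ᵀ ∙ (Qinv ∙ (B k ∙ V ⟪ σ ⟫))
          ≈⟨ ∙-cong (ᵀ-cong A∙V≈V⟪σ⟫) (∙-congˡ Qinv (∙-congˡ (B k) A∙V≈V⟪σ⟫)) ⟨
        (A ∙ V) ᵀ ∙ (Qinv ∙ (B k ∙ (A ∙ V)))
          ≈⟨ ∙-cong (ᵀ-∙ A V) (∙-congˡ Qinv B∙A∙V≈A∙B∙V) ⟩
        V ᵀ ∙ A ᵀ ∙ (Qinv ∙ (A ∙ (B k ∙ V)))
          ≈⟨ ∙-assoc (V ᵀ) (A ᵀ) (Qinv ∙ (A ∙ (B k ∙ V))) ⟩
        V ᵀ ∙ (A ᵀ ∙ (Qinv ∙ (A ∙ (B k ∙ V))))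
          ≈⟨ ∙-congˡ (V ᵀ) Aᵀ∙Qinv∙A-cancel ⟩
        W k ∎

theorem2 : (ℝ : RealField) → let open Linear ℝ in
    (n p r m : ℕ) (H : Fin m → Vect n) (v : Fin p → Vect n) (B : Fin (suc r) → Mat n) →
    FullDim (PolyCone H) → Pointed (PolyCone H) →
    (∀ i → IsExtremeRay (PolyCone H) (v i)) →
    (∀ x → IsExtremeRay (PolyCone H) x → ∃ λ i → InRay (v i) x) →
    (∀ i j → InRay (v j) (v i) → i ≡ j) →
    B zero ≐ₘ Id →
    (Qinv : Mat n) → (Qmat v ⊗ Qinv) ≐ₘ Id →
    (σ : Permutation′ p) →
    InLin v B σ ⇔
    (∀ i j k → wcol v B Qinv (σ ⟨$⟩ʳ i) (σ ⟨$⟩ʳ j) k ≡ wcol v B Qinv i j k)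
theorem2 ℝ n p r m H v B _ _ _ _ _ B₀≈Id Qinv Q∙Qinv≈Id σ =
  mk⇔ (InLin⇒automorphism σ) (automorphism⇒InLin σ)
  where open Matrices.LinearSymmetries ℝ v B B₀≈Id Qinv Q∙Qinv≈Id
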